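{- Let $H$ be an arbitrary graph on $n$ vertices, and let $k$ be a positive integer. Then: (i) $\mathfrak{C}(H,k) = \mathfrak{C}^\uparrow(H,k) \cap \mathfrak{C}^\downarrow(H,k)$; (ii) $\mathfrak{C}(H,k) = \mathfrak{C}^\uparrow(H,k) \cap F = \mathfrak{C}^\downarrow(H,k) \cap F$, where $F = \{x \in \mathbb{Q}^n : \sum_{u=1}^n x_u = k\}$.
   Context: Identify the vertex set of $H$ with $[n]=\{1,\dots,n\}$. A stable set in $H$ is a set of pairwise non-adjacent vertices; its incidence vector $\chi^S\in\{0,1\}^n$ has $\chi^S_i=1$ iff $i\in S$. Define $\mathfrak{C}(H,k)$ as the convex hull of the incidence vectors of stable sets of cardinality exactly $k$ in $H$; $\mathfrak{C}^\uparrow(H,k)$ as the convex hull of the incidence vectors of stable sets of cardinality at least $k$; and $\mathfrak{C}^\downarrow(H,k)$ as the convex hull of the incidence vectors of stable sets of cardinality at most $k$. -}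

module Defs where

open import Data.Nat using (ℕ)
open import Data.Bool using (Bool; true; false; if_then_else_)
open import Data.Fin using (Fin)
open import Data.Fin.Subset using (Subset; _∈_; ∣_∣)
open import Data.Vec using (lookup)
open import Data.List using (List; map; foldr; allFin)
open import Data.List.Relation.Unary.All using (All)
open import Data.Product using (Σ; _×_; _,_; proj₁; proj₂)
open import Data.Rational using (ℚ; 0ℚ; 1ℚ; _+_; _*_; _≤_)
open import Data.Nat using () renaming (_≤_ to _≤ℕ_)
import Data.Rational as ℚ
open import Data.Integer using (+_)
open import Relation.Binary.PropositionalEquality using (_≡_)
open import Relation.Nullary using (¬_)
open import Level using (0ℓ)

record Graph (n : ℕ) : Set₁ where
  field
    Adj    : Fin n → Fin n → Set
    sym    : ∀ {i j} → Adj i j → Adj j i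
    irrefl : ∀ {i} → ¬ Adj i i
open Graph public

Point : ℕ → Set
Point n = Fin n → ℚ

sumℚ : List ℚ → ℚ
sumℚ = foldr _+_ 0ℚ

coordSum : ∀ {n} → Point n → ℚ
coordSum {n} x = sumℚ (map x (allFin n))

Stable : ∀ {n} → Graph n → Subset n → Set
Stable H S = ∀ i j → i ∈ S → j ∈ S → ¬ Adj H i j

χ : ∀ {n} → Subset n → Point n
χ S i = if lookup S i then 1ℚ else 0ℚ

ConvHull : ∀ {n} → (Subset n → Set) → Point n → Set
ConvHull {n} P x =
  Σ (List (ℚ × Subset n)) λ l →
    All (λ p → (0ℚ ≤ proj₁ p) × P (proj₂ p)) l
    × sumℚ (map proj₁ l) ≡ 1ℚ
    × (∀ i → x i ≡ sumℚ (map (λ p → proj₁ p * χ (proj₂ p) i) l))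

C : ∀ {n} → Graph n → ℕ → Point n → Set
C H k = ConvHull (λ S → Stable H S × ∣ S ∣ ≡ k)

C↑ : ∀ {n} → Graph n → ℕ → Point n → Set
C↑ H k = ConvHull (λ S → Stable H S × k ≤ℕ ∣ S ∣)

C↓ : ∀ {n} → Graph n → ℕ → Point n → Set
C↓ H k = ConvHull (λ S → Stable H S × ∣ S ∣ ≤ℕ k)

F : ∀ {n} → ℕ → Point n → Set
F k x = coordSum x ≡ (+ k) ℚ./ 1

{-# OPTIONS --safe #-}
-- If x = Σ λ_S χ^S is a convex combination, then Σ_u x_u = Σ λ_S |S|.  When every S
-- in the combination has |S| ≥ k this is ≥ k, with equality exactly when every S of
-- positive weight has |S| = k; dually for |S| ≤ k.  So 𝔆↑ ∩ 𝔆↓ lies in F, and a point of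
-- 𝔆↑ or 𝔆↓ on F is a combination of k-sets only.
module Submission where

open import Defs
open import Data.Nat using (ℕ; _≤_)
open import Data.Product using (_×_)
open import Function.Bundles using (_⇔_)

open import Algebra.Bundles using (CommutativeMonoid; Ring)
import Data.Integer as ℤ
import Data.Integer.Properties as ℤ
import Data.Nat as ℕ
import Data.Nat.Properties as ℕ
import Data.Rational as ℚ
import Data.Rational.Properties as ℚ
open import Algebra.Properties.CommutativeSemigroup
  (CommutativeMonoid.commutativeSemigroup ℚ.+-0-commutativeMonoid) using (interchange)
open import Algebra.Properties.Group ℚ.+-0-group using (identityʳ-unique)
open import Algebra.Properties.Semiring.Sum (Ring.semiring ℚ.+-*-ring)
  using (sum; sum-cong-≗; sum-replicate-zero; ∑-distrib-+; *-distribˡ-sum)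
open import Data.Bool using (true; false)
open import Data.Fin.Subset using (Subset; ∣_∣)
open import Data.List using (List; []; _∷_; map; tabulate)
open import Data.List.Properties using (map-tabulate)
open import Data.List.Relation.Unary.All using (All; []; _∷_; zipWith)
  renaming (map to All-map)
open import Data.List.Relation.Unary.All.Properties using (map⁺; map⁻)
import Data.Nat.Coprimality as Coprimality
open import Data.Nat using (zero; suc; _∸_)
import Data.Product as Product
open import Data.Product using (Σ-syntax; _,_; proj₁; proj₂; uncurry)
open import Data.Rational using (ℚ; 0ℚ; 1ℚ; _+_; _*_; _/_; mkℚ)
import Data.Sum as Sum
open import Data.Sum using (_⊎_; inj₁; inj₂)
open import Data.Vec using ([]; _∷_)
open import Data.Vec.Functional using (head; tail)
open import Function using (id; const; _∘_)
open import Function.Bundles using (mk⇔)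
open import Relation.Binary.PropositionalEquality as ≡
  using (_≡_; _≗_; refl; trans; cong; cong₂; module ≡-Reasoning)

fromℕ : ℕ → ℚ
fromℕ m = ℤ.+ m / 1

fromℕ≡mkℚ : ∀ m → fromℕ m ≡ mkℚ (ℤ.+ m) 0 (Coprimality.sym (Coprimality.1-coprimeTo m))
fromℕ≡mkℚ m = ℚ.normalize-coprime (Coprimality.sym (Coprimality.1-coprimeTo m))

fromℕ-suc : ∀ m → fromℕ (suc m) ≡ 1ℚ + fromℕ m
-- ℚ addition computes the numerator 1 * 1 + m * 1 before normalising.
fromℕ-suc m rewrite fromℕ≡mkℚ m = cong (λ z → (ℤ.+ 1 ℤ.+ z) / 1) (≡.sym (ℤ.*-identityʳ (ℤ.+ m)))

fromℕ-+ : ∀ m n → fromℕ (m ℕ.+ n) ≡ fromℕ m + fromℕ n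
fromℕ-+ zero    n = ≡.sym (ℚ.+-identityˡ (fromℕ n))
fromℕ-+ (suc m) n = begin
  fromℕ (suc (m ℕ.+ n))      ≡⟨ fromℕ-suc (m ℕ.+ n) ⟩
  1ℚ + fromℕ (m ℕ.+ n)       ≡⟨ cong (1ℚ +_) (fromℕ-+ m n) ⟩
  1ℚ + (fromℕ m + fromℕ n)   ≡⟨ ≡.sym (ℚ.+-assoc 1ℚ (fromℕ m) (fromℕ n)) ⟩
  (1ℚ + fromℕ m) + fromℕ n   ≡⟨ cong (_+ fromℕ n) (≡.sym (fromℕ-suc m)) ⟩
  fromℕ (suc m) + fromℕ n    ∎
  where open ≡-Reasoning

fromℕ-nonNeg : ∀ m → 0ℚ ℚ.≤ fromℕ m
fromℕ-nonNeg m rewrite fromℕ≡mkℚ m = ℚ.nonNegative⁻¹ _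

*-nonNeg : ∀ {p q} → 0ℚ ℚ.≤ p → 0ℚ ℚ.≤ q → 0ℚ ℚ.≤ p * q
*-nonNeg {p} {q} 0≤p 0≤q = ℚ.nonNegative⁻¹ (p * q)
  {{ℚ.nonNeg*nonNeg⇒nonNeg p {{ℚ.nonNegative 0≤p}} q {{ℚ.nonNegative 0≤q}}}}

nonNeg+nonNeg≡0⇒ˡ≡0 : ∀ {p q} → 0ℚ ℚ.≤ p → 0ℚ ℚ.≤ q → p + q ≡ 0ℚ → p ≡ 0ℚ
nonNeg+nonNeg≡0⇒ˡ≡0 {p} {q} 0≤p 0≤q p+q≡0 = ℚ.≤-antisym p≤0 0≤p
  where
  open ℚ.≤-Reasoning
  p≤0 : p ℚ.≤ 0ℚ
  p≤0 = begin
    p       ≡⟨ ≡.sym (ℚ.+-identityʳ p) ⟩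
    p + 0ℚ  ≤⟨ ℚ.+-monoʳ-≤ p 0≤q ⟩
    p + q   ≡⟨ p+q≡0 ⟩
    0ℚ      ∎

*-fromℕ≡0 : ∀ {p} m → 0ℚ ℚ.≤ p → p * fromℕ m ≡ 0ℚ → p ≡ 0ℚ ⊎ m ≡ 0
*-fromℕ≡0     zero    _   _      = inj₂ refl
*-fromℕ≡0 {p} (suc m) 0≤p p*m+1≡0 =
  inj₁ (nonNeg+nonNeg≡0⇒ˡ≡0 0≤p (*-nonNeg 0≤p (fromℕ-nonNeg m)) (begin
    p + p * fromℕ m         ≡⟨ cong (_+ p * fromℕ m) (≡.sym (ℚ.*-identityʳ p)) ⟩
    p * 1ℚ + p * fromℕ m    ≡⟨ ≡.sym (ℚ.*-distribˡ-+ p 1ℚ (fromℕ m)) ⟩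
    p * (1ℚ + fromℕ m)      ≡⟨ cong (p *_) (≡.sym (fromℕ-suc m)) ⟩
    p * fromℕ (suc m)       ≡⟨ p*m+1≡0 ⟩
    0ℚ                      ∎))
  where open ≡-Reasoning

sumℚ-nonNeg : ∀ {xs} → All (0ℚ ℚ.≤_) xs → 0ℚ ℚ.≤ sumℚ xs
sumℚ-nonNeg []           = ℚ.≤-refl
sumℚ-nonNeg (0≤x ∷ 0≤xs) = ℚ.+-mono-≤ 0≤x (sumℚ-nonNeg 0≤xs)

sumℚ-nonNeg≡0 : ∀ {xs} → All (0ℚ ℚ.≤_) xs → sumℚ xs ≡ 0ℚ → All (_≡ 0ℚ) xs
sumℚ-nonNeg≡0 []                    _      = []
sumℚ-nonNeg≡0 {x ∷ xs} (0≤x ∷ 0≤xs) sum≡0 =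
  nonNeg+nonNeg≡0⇒ˡ≡0 0≤x (sumℚ-nonNeg 0≤xs) sum≡0 ∷
  sumℚ-nonNeg≡0 0≤xs
    (nonNeg+nonNeg≡0⇒ˡ≡0 (sumℚ-nonNeg 0≤xs) 0≤x (trans (ℚ.+-comm (sumℚ xs) x) sum≡0))

sumℚ-tabulate : ∀ {n} (x : Point n) → sumℚ (tabulate x) ≡ sum x
sumℚ-tabulate {zero}  x = refl
sumℚ-tabulate {suc n} x = cong (head x +_) (sumℚ-tabulate (tail x))

coordSum≡sum : ∀ {n} (x : Point n) → coordSum x ≡ sum x
coordSum≡sum x = trans (cong sumℚ (map-tabulate id x)) (sumℚ-tabulate x)

sum-χ : ∀ {n} (S : Subset n) → sum (χ S) ≡ fromℕ ∣ S ∣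
sum-χ []          = refl
sum-χ (true ∷ S)  = trans (cong (1ℚ +_) (sum-χ S)) (≡.sym (fromℕ-suc ∣ S ∣))
sum-χ (false ∷ S) = trans (cong (0ℚ +_) (sum-χ S)) (ℚ.+-identityˡ (fromℕ ∣ S ∣))

WeightedSets : ℕ → Set
WeightedSets n = List (ℚ × Subset n)

module _ {n : ℕ} where

  totalWeight : WeightedSets n → ℚ
  totalWeight l = sumℚ (map proj₁ l)

  combination : WeightedSets n → Point n
  combination l i = sumℚ (map (λ p → proj₁ p * χ (proj₂ p) i) l)

  weightedTerm : (Subset n → ℕ) → ℚ × Subset n → ℚ
  weightedTerm f p = proj₁ p * fromℕ (f (proj₂ p))

  weighted : (Subset n → ℕ) → WeightedSets n → ℚ
  weighted f l = sumℚ (map (weightedTerm f) l)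

  NonNegWeights : WeightedSets n → Set
  NonNegWeights = All (λ p → 0ℚ ℚ.≤ proj₁ p)

  sum-combination : ∀ l → sum (combination l) ≡ weighted ∣_∣ l
  sum-combination []            = sum-replicate-zero n
  sum-combination ((w , S) ∷ l) = begin
    sum (λ i → w * χ S i + combination l i)       ≡⟨ ∑-distrib-+ (λ i → w * χ S i) (combination l) ⟩
    sum (λ i → w * χ S i) + sum (combination l)   ≡⟨ cong₂ _+_ (≡.sym (*-distribˡ-sum w (χ S))) (sum-combination l) ⟩
    w * sum (χ S) + weighted ∣_∣ l                ≡⟨ cong (λ s → w * s + weighted ∣_∣ l) (sum-χ S) ⟩
    w * fromℕ ∣ S ∣ + weighted ∣_∣ l              ∎
    where open ≡-Reasoning

  weighted-const : ∀ k l → weighted (const k) l ≡ totalWeight l * fromℕ k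
  weighted-const k []            = ≡.sym (ℚ.*-zeroˡ (fromℕ k))
  weighted-const k ((w , S) ∷ l) = trans (cong (w * fromℕ k +_) (weighted-const k l))
    (≡.sym (ℚ.*-distribʳ-+ (fromℕ k) w (totalWeight l)))

  terms-nonNeg : ∀ f {l} → NonNegWeights l → All (0ℚ ℚ.≤_) (map (weightedTerm f) l)
  terms-nonNeg f 0≤ws = map⁺ (All-map (λ {p} 0≤w → *-nonNeg 0≤w (fromℕ-nonNeg (f (proj₂ p)))) 0≤ws)

  weighted-nonNeg : ∀ f {l} → NonNegWeights l → 0ℚ ℚ.≤ weighted f l
  weighted-nonNeg f 0≤ws = sumℚ-nonNeg (terms-nonNeg f 0≤ws)

  weighted≡0 : ∀ f {l} → NonNegWeights l → weighted f l ≡ 0ℚ →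
               All (λ p → proj₁ p ≡ 0ℚ ⊎ f (proj₂ p) ≡ 0) l
  weighted≡0 f 0≤ws w≡0 = zipWith (λ {p} (0≤w , term≡0) → *-fromℕ≡0 (f (proj₂ p)) 0≤w term≡0)
    (0≤ws , map⁻ (sumℚ-nonNeg≡0 (terms-nonNeg f 0≤ws) w≡0))

  module _ (f g : Subset n → ℕ) where

    gap : Subset n → ℕ
    gap S = g S ∸ f S

    Below : WeightedSets n → Set
    Below = All (λ p → f (proj₂ p) ≤ g (proj₂ p))

    weighted-split : ∀ {l} → Below l → weighted g l ≡ weighted f l + weighted gap l
    weighted-split []                        = ≡.sym (ℚ.+-identityˡ 0ℚ)
    weighted-split {(w , S) ∷ l} (f≤g ∷ f≤gs) = begin
      w * fromℕ (g S) + weighted g l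
        ≡⟨ cong₂ _+_ (cong (λ m → w * fromℕ m) (≡.sym (ℕ.m+[n∸m]≡n f≤g))) (weighted-split f≤gs) ⟩
      w * fromℕ (f S ℕ.+ gap S) + (weighted f l + weighted gap l)
        ≡⟨ cong (_+ (weighted f l + weighted gap l))
             (trans (cong (w *_) (fromℕ-+ (f S) (gap S))) (ℚ.*-distribˡ-+ w _ _)) ⟩
      (weightedTerm f (w , S) + weightedTerm gap (w , S)) + (weighted f l + weighted gap l)
        ≡⟨ interchange (weightedTerm f (w , S)) (weightedTerm gap (w , S)) (weighted f l) (weighted gap l) ⟩
      (weightedTerm f (w , S) + weighted f l) + (weightedTerm gap (w , S) + weighted gap l) ∎
      where open ≡-Reasoning

    weighted-mono-≤ : ∀ {l} → NonNegWeights l → Below l → weighted f l ℚ.≤ weighted g l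
    weighted-mono-≤ {l} 0≤ws f≤gs = begin
      weighted f l                   ≡⟨ ≡.sym (ℚ.+-identityʳ (weighted f l)) ⟩
      weighted f l + 0ℚ              ≤⟨ ℚ.+-monoʳ-≤ (weighted f l) (weighted-nonNeg gap 0≤ws) ⟩
      weighted f l + weighted gap l  ≡⟨ ≡.sym (weighted-split f≤gs) ⟩
      weighted g l                   ∎
      where open ℚ.≤-Reasoning

    weighted-tight : ∀ {l} → NonNegWeights l → Below l → weighted g l ≡ weighted f l →
                     All (λ p → proj₁ p ≡ 0ℚ ⊎ f (proj₂ p) ≡ g (proj₂ p)) l
    weighted-tight 0≤ws f≤gs g≡f =
      zipWith (λ (f≤g , null-or-gap≡0) →
                 Sum.map₂ (λ gap≡0 → ℕ.≤-antisym f≤g (ℕ.m∸n≡0⇒m≤n gap≡0)) null-or-gap≡0)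
        (f≤gs , weighted≡0 gap 0≤ws (identityʳ-unique _ _ (trans (≡.sym (weighted-split f≤gs)) g≡f)))

module _ {n : ℕ} {P : Subset n → Set} where

  ConvHull-mono : ∀ {Q : Subset n → Set} → (∀ {S} → P S → Q S) → ∀ {x} → ConvHull P x → ConvHull Q x
  ConvHull-mono P⇒Q (l , ok , total≡1 , x≗) = l , All-map (Product.map₂ P⇒Q) ok , total≡1 , x≗

  prune : ∀ l → All (λ p → 0ℚ ℚ.≤ proj₁ p × (proj₁ p ≡ 0ℚ ⊎ P (proj₂ p))) l →
          Σ[ l′ ∈ WeightedSets n ] All (λ p → 0ℚ ℚ.≤ proj₁ p × P (proj₂ p)) l′
            × totalWeight l′ ≡ totalWeight l × combination l′ ≗ combination l
  prune []            []                        = [] , [] , refl , λ _ → refl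
  prune ((w , S) ∷ l) ((0≤w , inj₂ PS) ∷ ok)
    with l′ , ok′ , total≡ , comb≗ ← prune l ok =
    (w , S) ∷ l′ , (0≤w , PS) ∷ ok′ , cong (w +_) total≡ , λ i → cong (w * χ S i +_) (comb≗ i)
  prune ((w , S) ∷ l) ((_ , inj₁ refl) ∷ ok)
    with l′ , ok′ , total≡ , comb≗ ← prune l ok =
    l′ , ok′ , trans total≡ (≡.sym (ℚ.+-identityˡ (totalWeight l))) , λ i → trans (comb≗ i) (≡.sym (begin
      0ℚ * χ S i + combination l i   ≡⟨ cong (_+ combination l i) (ℚ.*-zeroˡ (χ S i)) ⟩
      0ℚ + combination l i           ≡⟨ ℚ.+-identityˡ (combination l i) ⟩
      combination l i                ∎))
    where open ≡-Reasoning

  ConvHull-prune : ∀ {x} l → All (λ p → 0ℚ ℚ.≤ proj₁ p × (proj₁ p ≡ 0ℚ ⊎ P (proj₂ p))) l →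
                   totalWeight l ≡ 1ℚ → x ≗ combination l → ConvHull P x
  ConvHull-prune l ok total≡1 x≗ with l′ , ok′ , total≡ , comb≗ ← prune l ok =
    l′ , ok′ , trans total≡ total≡1 , λ i → trans (x≗ i) (≡.sym (comb≗ i))

module _ {n : ℕ} {P : Subset n → Set} where

  ConvHull-coordSum : ∀ {x} (h : ConvHull P x) → coordSum x ≡ weighted ∣_∣ (proj₁ h)
  ConvHull-coordSum {x} (l , _ , _ , x≗) =
    trans (coordSum≡sum x) (trans (sum-cong-≗ x≗) (sum-combination l))

  ConvHull-const : ∀ {x} k (h : ConvHull P x) → weighted (const k) (proj₁ h) ≡ fromℕ k
  ConvHull-const k (l , _ , total≡1 , _) =
    trans (weighted-const k l) (trans (cong (_* fromℕ k) total≡1) (ℚ.*-identityˡ (fromℕ k)))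

  module _ (f g : Subset n → ℕ) (f≤g : ∀ {S} → P S → f S ≤ g S) {x : Point n} where

    ConvHull-weighted-mono-≤ : (h : ConvHull P x) → weighted f (proj₁ h) ℚ.≤ weighted g (proj₁ h)
    ConvHull-weighted-mono-≤ (l , ok , _ , _) =
      weighted-mono-≤ f g (All-map proj₁ ok) (All-map (f≤g ∘ proj₂) ok)

    ConvHull-tight : (h : ConvHull P x) → weighted g (proj₁ h) ≡ weighted f (proj₁ h) →
                     ConvHull (λ S → P S × f S ≡ g S) x
    ConvHull-tight (l , ok , total≡1 , x≗) g≡f = ConvHull-prune l
      (zipWith (λ ((0≤w , PS) , null-or-tight) → 0≤w , Sum.map₂ (PS ,_) null-or-tight)
        (ok , weighted-tight f g (All-map proj₁ ok) (All-map (f≤g ∘ proj₂) ok) g≡f))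
      total≡1 x≗

  module _ {k : ℕ} {x : Point n} where

    ConvHull-coordSum-≥ : (∀ {S} → P S → k ≤ ∣ S ∣) → ConvHull P x → fromℕ k ℚ.≤ coordSum x
    ConvHull-coordSum-≥ k≤ h = begin
      fromℕ k                       ≡⟨ ≡.sym (ConvHull-const k h) ⟩
      weighted (const k) (proj₁ h)  ≤⟨ ConvHull-weighted-mono-≤ (const k) ∣_∣ k≤ h ⟩
      weighted ∣_∣ (proj₁ h)        ≡⟨ ≡.sym (ConvHull-coordSum h) ⟩
      coordSum x                    ∎
      where open ℚ.≤-Reasoning

    ConvHull-coordSum-≤ : (∀ {S} → P S → ∣ S ∣ ≤ k) → ConvHull P x → coordSum x ℚ.≤ fromℕ k
    ConvHull-coordSum-≤ ≤k h = begin
      coordSum x                    ≡⟨ ConvHull-coordSum h ⟩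
      weighted ∣_∣ (proj₁ h)        ≤⟨ ConvHull-weighted-mono-≤ ∣_∣ (const k) ≤k h ⟩
      weighted (const k) (proj₁ h)  ≡⟨ ConvHull-const k h ⟩
      fromℕ k                       ∎
      where open ℚ.≤-Reasoning

    ConvHull-tight-≥ : (∀ {S} → P S → k ≤ ∣ S ∣) → ConvHull P x → coordSum x ≡ fromℕ k →
                       ConvHull (λ S → P S × k ≡ ∣ S ∣) x
    ConvHull-tight-≥ k≤ h sum≡k = ConvHull-tight (const k) ∣_∣ k≤ h
      (trans (≡.sym (ConvHull-coordSum h)) (trans sum≡k (≡.sym (ConvHull-const k h))))

    ConvHull-tight-≤ : (∀ {S} → P S → ∣ S ∣ ≤ k) → ConvHull P x → coordSum x ≡ fromℕ k →
                       ConvHull (λ S → P S × ∣ S ∣ ≡ k) x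
    ConvHull-tight-≤ ≤k h sum≡k = ConvHull-tight ∣_∣ (const k) ≤k h
      (trans (ConvHull-const k h) (trans (≡.sym sum≡k) (ConvHull-coordSum h)))

module _ {n : ℕ} (H : Graph n) (k : ℕ) {x : Point n} where

  C⇒C↑ : C H k x → C↑ H k x
  C⇒C↑ = ConvHull-mono (Product.map₂ (λ |S|≡k → ℕ.≤-reflexive (≡.sym |S|≡k)))

  C⇒C↓ : C H k x → C↓ H k x
  C⇒C↓ = ConvHull-mono (Product.map₂ ℕ.≤-reflexive)

  C↑∩C↓⇒F : C↑ H k x → C↓ H k x → F k x
  C↑∩C↓⇒F c↑ c↓ = ℚ.≤-antisym (ConvHull-coordSum-≤ proj₂ c↓) (ConvHull-coordSum-≥ proj₂ c↑)

  C⇒F : C H k x → F k x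
  C⇒F c = C↑∩C↓⇒F (C⇒C↑ c) (C⇒C↓ c)

  C↑∩F⇒C : C↑ H k x → F k x → C H k x
  C↑∩F⇒C c↑ sum≡k =
    ConvHull-mono (λ ((stable , _) , k≡|S|) → stable , ≡.sym k≡|S|) (ConvHull-tight-≥ proj₂ c↑ sum≡k)

  C↓∩F⇒C : C↓ H k x → F k x → C H k x
  C↓∩F⇒C c↓ sum≡k =
    ConvHull-mono (Product.map₁ proj₁) (ConvHull-tight-≤ proj₂ c↓ sum≡k)

theorem2p1 : (n : ℕ) (H : Graph n) (k : ℕ) → 1 ≤ k →
    (∀ (x : Point n) → C H k x ⇔ (C↑ H k x × C↓ H k x))
    × (∀ (x : Point n) → (C H k x ⇔ (C↑ H k x × F k x)) × (C H k x ⇔ (C↓ H k x × F k x)))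
theorem2p1 n H k _ =
  (λ x → mk⇔ (λ c → C⇒C↑ H k c , C⇒C↓ H k c)
             (λ (c↑ , c↓) → C↑∩F⇒C H k c↑ (C↑∩C↓⇒F H k c↑ c↓))) ,
  (λ x → mk⇔ (λ c → C⇒C↑ H k c , C⇒F H k c) (uncurry (C↑∩F⇒C H k)) ,
         mk⇔ (λ c → C⇒C↓ H k c , C⇒F H k c) (uncurry (C↓∩F⇒C H k)))
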